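{- Let $G$ be a finite simple graph whose distance-$2$ graph $G_2$ is triangle-free. Then $G$ contains none of the following as an induced subgraph: the claw $K_{1,3}$; the cycle $C_6$; the graph $C_6'$; the graph $C_6''$.
   Context: The distance-$2$ graph $G_2$ has vertex set $V(G)$, with $\{x,y\}$ an edge iff $d_G(x,y)=2$. With $C_6=v_1v_2v_3v_4v_5v_6v_1$, $C_6'$ is $C_6$ plus the edge $v_1v_3$, and $C_6''$ is $C_6$ plus the edges $v_1v_3$ and $v_3v_5$. -}

module Defs where

open import Data.Nat using (ℕ; zero; suc; _<_; _≡ᵇ_)
open import Data.Fin using (Fin; toℕ)
open import Data.Bool using (Bool; true; false; _∧_; _∨_; T)
open import Data.List using (List; []; _∷_)
open import Data.Bool.ListAction using (any)
open import Data.Product using (Σ; ∃; _×_; _,_)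
open import Data.Empty using (⊥)
open import Relation.Nullary using (¬_)
open import Relation.Binary.PropositionalEquality using (_≡_; _≢_)
open import Function.Definitions using (Injective)
open import Function.Bundles using (_⇔_)

record Graph (n : ℕ) : Set₁ where
  field
    Adj   : Fin n → Fin n → Set
    sym   : ∀ {x y} → Adj x y → Adj y x
    irrefl : ∀ {x} → ¬ Adj x x
open Graph public

data Walk {n : ℕ} (G : Graph n) : ℕ → Fin n → Fin n → Set where
  nil  : ∀ {x} → Walk G 0 x x
  cons : ∀ {k x y z} → Adj G x y → Walk G k y z → Walk G (suc k) x z

Dist2 : ∀ {n} → Graph n → Fin n → Fin n → Set
Dist2 G x y = Σ (Walk G 2 x y) (λ _ → ∀ k → k < 2 → ¬ Walk G k x y)

G2TriangleFree : ∀ {n} → Graph n → Set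
G2TriangleFree {n} G =
  ∀ (x y z : Fin n) → ¬ (Dist2 G x y × Dist2 G y z × Dist2 G x z)

edgeB : ∀ {m} → List (ℕ × ℕ) → Fin m → Fin m → Bool
edgeB es i j = any (λ { (a , b) → ((a ≡ᵇ toℕ i) ∧ (b ≡ᵇ toℕ j))
                                 ∨ ((a ≡ᵇ toℕ j) ∧ (b ≡ᵇ toℕ i)) }) es

InducedSub : ∀ {m n} → (Fin m → Fin m → Bool) → Graph n → Set
InducedSub {m} {n} H G =
  Σ (Fin m → Fin n) λ f → Injective _≡_ _≡_ f ×
    (∀ i j → T (H i j) ⇔ Adj G (f i) (f j))

claw : Fin 4 → Fin 4 → Bool
claw = edgeB ((0 , 1) ∷ (0 , 2) ∷ (0 , 3) ∷ [])

-- C6 = v1…v6 with v_i labelled i-1.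
C6-edges : List (ℕ × ℕ)
C6-edges = (0 , 1) ∷ (1 , 2) ∷ (2 , 3) ∷ (3 , 4) ∷ (4 , 5) ∷ (5 , 0) ∷ []

C6 : Fin 6 → Fin 6 → Bool
C6 = edgeB C6-edges

C6′ : Fin 6 → Fin 6 → Bool
C6′ = edgeB ((0 , 2) ∷ C6-edges)

C6″ : Fin 6 → Fin 6 → Bool
C6″ = edgeB ((0 , 2) ∷ (2 , 4) ∷ C6-edges)

-- Each forbidden graph H has three pairwise non-adjacent vertices every two of
-- which share a neighbour (the leaves of the claw; v2, v4, v6 in the hexagons).
-- An induced copy of H keeps both the common neighbours and the non-adjacencies,
-- so those three vertices are pairwise at distance 2 in G: a triangle in G_2.
module Submission where

open import Defs
open import Data.Nat using (zero; suc; _<_; s≤s)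
open import Data.Fin using (Fin; #_)
open import Data.Bool using (Bool; T)
open import Data.Product using (∃; _×_; _,_)
open import Data.Unit using (tt)
open import Relation.Nullary using (¬_)
open import Relation.Binary.PropositionalEquality using (_≡_; refl; _≢_)
open import Function.Bundles using (Equivalence)

module _ {n} {G : Graph n} where

  walk₀⇒≡ : ∀ {x y} → Walk G 0 x y → x ≡ y
  walk₀⇒≡ nil = refl

  walk₁⇒Adj : ∀ {x y} → Walk G 1 x y → Adj G x y
  walk₁⇒Adj (cons a nil) = a

  path₂⇒Dist2 : ∀ {x y z} → x ≢ z → ¬ Adj G x z → Adj G x y → Adj G y z → Dist2 G x z
  path₂⇒Dist2 x≢z ¬xz xy yz = cons xy (cons yz nil) , shorter
    where
    shorter : ∀ k → k < 2 → ¬ Walk G k _ _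
    shorter zero          _              w = x≢z (walk₀⇒≡ w)
    shorter (suc zero)    _              w = ¬xz (walk₁⇒Adj w)
    shorter (suc (suc k)) (s≤s (s≤s ())) _

module _ {m} (H : Fin m → Fin m → Bool) where

  PatternDist2 : Fin m → Fin m → Set
  PatternDist2 i j = i ≢ j × ¬ T (H i j) × ∃ λ k → T (H i k) × T (H k j)

  PatternG2Triangle : Set
  PatternG2Triangle = ∃ λ i → ∃ λ j → ∃ λ k →
    PatternDist2 i j × PatternDist2 j k × PatternDist2 i k

module _ {m n} {H : Fin m → Fin m → Bool} {G : Graph n} where

  InducedSub⇒Dist2 : ((f , _ , _) : InducedSub H G) → ∀ {i j} →
                     PatternDist2 H i j → Dist2 G (f i) (f j)
  InducedSub⇒Dist2 (f , inj , iff) (i≢j , ¬ij , k , ik , kj) =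
    path₂⇒Dist2 (λ fi≡fj → i≢j (inj fi≡fj)) (λ a → ¬ij (reflect a)) (embed ik) (embed kj)
    where
    embed : ∀ {i j} → T (H i j) → Adj G (f i) (f j)
    embed {i} {j} = Equivalence.to (iff i j)
    reflect : ∀ {i j} → Adj G (f i) (f j) → T (H i j)
    reflect {i} {j} = Equivalence.from (iff i j)

  G2TriangleFree⇒¬InducedSub : G2TriangleFree G → PatternG2Triangle H → ¬ InducedSub H G
  G2TriangleFree⇒¬InducedSub free (i , j , k , ij , jk , ik) e@(f , _) =
    free (f i) (f j) (f k)
      (InducedSub⇒Dist2 e ij , InducedSub⇒Dist2 e jk , InducedSub⇒Dist2 e ik)

claw-G2Triangle : PatternG2Triangle claw
claw-G2Triangle =
  # 1 , # 2 , # 3 ,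
  ((λ ()) , (λ ()) , # 0 , tt , tt) ,
  ((λ ()) , (λ ()) , # 0 , tt , tt) ,
  ((λ ()) , (λ ()) , # 0 , tt , tt)

-- The chords of C6′ and C6″ avoid the pairs among v2, v4, v6 (labels 1, 3, 5).
hexagon-G2Triangle : (H : Fin 6 → Fin 6 → Bool) →
  T (H (# 1) (# 2)) → T (H (# 2) (# 3)) → T (H (# 3) (# 4)) → T (H (# 4) (# 5)) →
  T (H (# 1) (# 0)) → T (H (# 0) (# 5)) →
  ¬ T (H (# 1) (# 3)) → ¬ T (H (# 3) (# 5)) → ¬ T (H (# 1) (# 5)) →
  PatternG2Triangle H
hexagon-G2Triangle H e₁₂ e₂₃ e₃₄ e₄₅ e₁₀ e₀₅ ¬e₁₃ ¬e₃₅ ¬e₁₅ =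
  # 1 , # 3 , # 5 ,
  ((λ ()) , ¬e₁₃ , # 2 , e₁₂ , e₂₃) ,
  ((λ ()) , ¬e₃₅ , # 4 , e₃₄ , e₄₅) ,
  ((λ ()) , ¬e₁₅ , # 0 , e₁₀ , e₀₅)

lemma2p1 : ∀ {n} (G : Graph n) → G2TriangleFree G →
    ¬ InducedSub claw G × ¬ InducedSub C6 G × ¬ InducedSub C6′ G × ¬ InducedSub C6″ G
lemma2p1 G free =
    excluded claw-G2Triangle
  , excluded (hexagon-G2Triangle C6  tt tt tt tt tt tt (λ ()) (λ ()) (λ ()))
  , excluded (hexagon-G2Triangle C6′ tt tt tt tt tt tt (λ ()) (λ ()) (λ ()))
  , excluded (hexagon-G2Triangle C6″ tt tt tt tt tt tt (λ ()) (λ ()) (λ ()))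
  where
  excluded : ∀ {m} {H : Fin m → Fin m → Bool} → PatternG2Triangle H → ¬ InducedSub H G
  excluded = G2TriangleFree⇒¬InducedSub free
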